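{- For integers $a,b\ge0$ and $1\le r\le a+b+1$, $$c^r_{a,b}=\sum_{\substack{0\le\alpha\le a\\0\le\beta\le b\\ \alpha+\beta+1=r}}c^r_{\alpha,\beta}-\sum_{\substack{0\le\alpha<a\\0\le\beta\le b\\ \alpha+\beta+1=r}}c^r_{\beta,\alpha}+2\cdot(-1)^r\big(\mathbb I(a\ge r)-\mathbb I(b\ge r)\big).$$
   Context: For integers $a,b,r\ge0$, $$c_{a,b}^r=2\cdot(-1)^r\Big(\binom{2r}{2b+2}-(1-2^{ -2r})\binom{2r}{2a+1}\Big),$$ where $\binom{n}{k}=0$ for $k>n$. $\mathbb I$ denotes the indicator function: $\mathbb I(A)=1$ if the statement $A$ is true and $0$ otherwise. -}

module Defs where

open import Data.Nat as ℕ using (ℕ; zero; suc; _≤?_; _<?_; _≟_)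
open import Data.Nat.Properties using (m^n≢0)
open import Data.Nat.Combinatorics using (_C_)
open import Data.Integer as ℤ using (ℤ; +_)
open import Data.Rational using (ℚ; _/_; _+_; _-_; _*_; -_; 0ℚ; 1ℚ)
open import Relation.Nullary.Decidable using (Dec; yes; no)

ℕ→ℚ : ℕ → ℚ
ℕ→ℚ n = + n / 1

sgn : ℕ → ℚ
sgn zero = 1ℚ
sgn (suc r) = - sgn r

-- 2^{-2r} = 1 / 4^r
inv4^ : ℕ → ℚ
inv4^ r = + 1 / (4 ℕ.^ r)
  where instance _ = m^n≢0 4 r

-- c^r_{a,b} = 2·(-1)^r ( C(2r,2b+2) - (1 - 2^{-2r}) C(2r,2a+1) ),
-- with C(n,k) = 0 for k > n (as in Data.Nat.Combinatorics._C_).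
c : ℕ → ℕ → ℕ → ℚ
c a b r = (ℕ→ℚ 2 * sgn r) *
  (ℕ→ℚ ((2 ℕ.* r) C (2 ℕ.* b ℕ.+ 2))
   - (1ℚ - inv4^ r) * ℕ→ℚ ((2 ℕ.* r) C (2 ℕ.* a ℕ.+ 1)))

Σ< : ℕ → (ℕ → ℚ) → ℚ
Σ< zero f = 0ℚ
Σ< (suc n) f = Σ< n f + f n

-- restriction of a term to the indices satisfying a decidable condition
when : {P : Set} → Dec P → ℚ → ℚ
when (yes _) q = q
when (no _) q = 0ℚ

𝕀 : {P : Set} → Dec P → ℚ
𝕀 d = when d 1ℚ

-- Put r = q + 1, s = 2(-1)^r, k = 1 - 2^{-2r}, E j = C(2r,2j), O j = C(2r,2j+1).
-- By the symmetry of binomial coefficients, on the line α + β + 1 = r we have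
-- c^r_{α,β} = s (E α - k O α) and c^r_{β,α} = s (E (α+1) - k O α), so the
-- difference of the two double sums telescopes in α.  What survives is
-- s (E (q ∸ b) - k O a) - s 𝕀(a ≥ r), and E (q ∸ b) = C(2r,2b+2) + 𝕀(b ≥ r),
-- which is c^r_{a,b} up to the indicator terms.
module Submission where

open import Defs
open import Data.Nat as ℕ using (ℕ; zero; suc; _≤_; _<_; _≤′_; _∸_; z≤n; s≤s; _≤?_; _≟_)
open import Data.Nat.Properties as ℕP using (≤⇒≤′; ≤′⇒≤)
open import Data.Nat.Combinatorics using (_C_; nCk≡nC[n∸k]; nCn≡1; k>n⇒nCk≡0)
open import Data.Nat.Tactic.RingSolver using (solve-∀)
open import Data.Rational using (ℚ; _+_; _-_; _*_; 0ℚ; 1ℚ)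
open import Data.Rational.Properties using (+-identityˡ; +-identityʳ)
open import Data.Rational.Solver using (module +-*-Solver)
open import Data.Sum using (_⊎_; inj₁; inj₂)
open import Relation.Binary.PropositionalEquality
  using (_≡_; _≢_; refl; sym; trans; cong; cong₂; module ≡-Reasoning)
open import Relation.Nullary using (Dec; yes; no; ¬_; contradiction)

open +-*-Solver

when-yes : {P : Set} (d : Dec P) → P → ∀ x → when d x ≡ x
when-yes (yes _) _ x = refl
when-yes (no ¬p) p x = contradiction p ¬p

when-no : {P : Set} (d : Dec P) → ¬ P → ∀ x → when d x ≡ 0ℚ
when-no (yes p) ¬p x = contradiction p ¬p
when-no (no _)  _  x = refl

Σ<-zero : ∀ n {f : ℕ → ℚ} → (∀ {i} → i < n → f i ≡ 0ℚ) → Σ< n f ≡ 0ℚ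
Σ<-zero zero    f≡0 = refl
Σ<-zero (suc n) f≡0 =
  cong₂ _+_ (Σ<-zero n (λ i<n → f≡0 (ℕP.m<n⇒m<1+n i<n))) (f≡0 ℕP.≤-refl)

Σ<-single : ∀ n {f : ℕ → ℚ} {j} → j < n →
  (∀ {i} → i < n → i ≢ j → f i ≡ 0ℚ) → Σ< n f ≡ f j
Σ<-single (suc n) {f} {j} j<1+n f≡0 with j ≟ n
... | yes refl = trans (cong (_+ f j) (Σ<-zero n (λ i<n → f≡0 (ℕP.m<n⇒m<1+n i<n) (ℕP.<⇒≢ i<n))))
                       (+-identityˡ (f j))
... | no j≢n   = trans (cong₂ _+_ (Σ<-single n (ℕP.≤∧≢⇒< (ℕP.≤-pred j<1+n) j≢n)
                                             (λ i<n → f≡0 (ℕP.m<n⇒m<1+n i<n)))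
                                  (f≡0 ℕP.≤-refl (λ n≡j → j≢n (sym n≡j))))
                       (+-identityʳ (f j))

Σ<-sub : ∀ n (f g : ℕ → ℚ) → Σ< n f - Σ< n g ≡ Σ< n (λ i → f i - g i)
Σ<-sub zero    f g = refl
Σ<-sub (suc n) f g = trans (interchange (Σ< n f) (f n) (Σ< n g) (g n))
                           (cong (_+ (f n - g n)) (Σ<-sub n f g))
  where
  interchange : ∀ w x y z → (w + x) - (y + z) ≡ (w - y) + (x - z)
  interchange = solve 4 (λ w x y z → (w :+ x) :- (y :+ z) := (w :- y) :+ (x :- z)) refl

Σ<-extend : ∀ {m n} (f : ℕ → ℚ) → (∀ {i} → m ≤ i → f i ≡ 0ℚ) → m ≤ n → Σ< n f ≡ Σ< m f
Σ<-extend {m} f f≡0 m≤n = go (≤⇒≤′ m≤n)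
  where
  go : ∀ {n} → m ≤′ n → Σ< n f ≡ Σ< m f
  go ℕ.≤′-refl       = refl
  go (ℕ.≤′-step m≤n) = trans (cong₂ _+_ (go m≤n) (f≡0 (≤′⇒≤ m≤n))) (+-identityʳ (Σ< m f))

Σ<-telescope : ∀ {m n} (f g : ℕ → ℚ) → (∀ {i} → i < m → f i ≡ 0ℚ) →
  (∀ {i} → m ≤ i → i < n → f i ≡ g i - g (suc i)) → m ≤ n → Σ< n f ≡ g m - g n
Σ<-telescope {m} f g f≡0 f≡Δg m≤n = go (≤⇒≤′ m≤n) f≡Δg
  where
  go : ∀ {n} → m ≤′ n → (∀ {i} → m ≤ i → i < n → f i ≡ g i - g (suc i)) → Σ< n f ≡ g m - g n
  go ℕ.≤′-refl       _    = trans (Σ<-zero m f≡0) (solve 1 (λ x → con 0ℚ := x :- x) refl (g m))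
  go (ℕ.≤′-step m≤n) f≡Δg =
    trans (cong₂ _+_ (go m≤n (λ m≤i i<n → f≡Δg m≤i (ℕP.m<n⇒m<1+n i<n)))
                     (f≡Δg (≤′⇒≤ m≤n) ℕP.≤-refl))
          (solve 3 (λ x y z → (x :- y) :+ (y :- z) := x :- z) refl (g m) _ (g (suc _)))

C-sym : ∀ {n} i j → i ℕ.+ j ≡ n → n C i ≡ n C j
C-sym i j refl = trans (nCk≡nC[n∸k] (ℕP.m≤m+n i j)) (cong ((i ℕ.+ j) C_) (ℕP.m+n∸m≡n i j))

onLine : ℕ → ℕ → (ℕ → ℕ → ℚ) → ℕ → ℚ
onLine b r g α = Σ< (suc b) (λ β → when (α ℕ.+ β ℕ.+ 1 ≟ r) (g α β))

onLine-hit : ∀ {b r α β} (g : ℕ → ℕ → ℚ) → β ≤ b → α ℕ.+ β ℕ.+ 1 ≡ r → onLine b r g α ≡ g α β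
onLine-hit {b} {r} {α} {β} g β≤b onLine =
  trans (Σ<-single (suc b) (s≤s β≤b) off) (when-yes (α ℕ.+ β ℕ.+ 1 ≟ r) onLine (g α β))
  where
  off : ∀ {i} → i < suc b → i ≢ β → when (α ℕ.+ i ℕ.+ 1 ≟ r) (g α i) ≡ 0ℚ
  off {i} _ i≢β = when-no (α ℕ.+ i ℕ.+ 1 ≟ r)
    (λ onLine′ → i≢β (ℕP.+-cancelˡ-≡ α _ _ (ℕP.+-cancelʳ-≡ 1 _ _ (trans onLine′ (sym onLine))))) (g α i)

onLine-miss : ∀ {b r α} (g : ℕ → ℕ → ℚ) → (∀ {β} → β ≤ b → α ℕ.+ β ℕ.+ 1 ≢ r) → onLine b r g α ≡ 0ℚ
onLine-miss {b} {r} {α} g off =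
  Σ<-zero (suc b) (λ {i} i≤b → when-no (α ℕ.+ i ℕ.+ 1 ≟ r) (off (ℕP.≤-pred i≤b)) (g α i))

even-sum : ∀ α β → 2 ℕ.* β ℕ.+ 2 ℕ.+ 2 ℕ.* α ≡ 2 ℕ.* suc (α ℕ.+ β)
even-sum = solve-∀

odd-sum : ∀ α β → 2 ℕ.* β ℕ.+ 1 ℕ.+ (2 ℕ.* α ℕ.+ 1) ≡ 2 ℕ.* suc (α ℕ.+ β)
odd-sum = solve-∀

double-suc : ∀ α → 2 ℕ.* α ℕ.+ 2 ≡ 2 ℕ.* suc α
double-suc = solve-∀

module Coefficients (q : ℕ) where

  r : ℕ
  r = suc q

  s k : ℚ
  s = ℕ→ℚ 2 * sgn r
  k = 1ℚ - inv4^ r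

  E O : ℕ → ℚ
  E j = ℕ→ℚ ((2 ℕ.* r) C (2 ℕ.* j))
  O j = ℕ→ℚ ((2 ℕ.* r) C (2 ℕ.* j ℕ.+ 1))

  c-onLine : ∀ {α β} → α ℕ.+ β ≡ q → c α β r ≡ s * (E α - k * O α)
  c-onLine {α} {β} α+β≡q = cong (λ x → s * (ℕ→ℚ x - k * O α))
    (C-sym (2 ℕ.* β ℕ.+ 2) (2 ℕ.* α) (trans (even-sum α β) (cong (λ x → 2 ℕ.* suc x) α+β≡q)))

  c-onLine-swap : ∀ {α β} → α ℕ.+ β ≡ q → c β α r ≡ s * (E (suc α) - k * O α)
  c-onLine-swap {α} {β} α+β≡q = cong₂ (λ x y → s * (ℕ→ℚ x - k * ℕ→ℚ y))
    (cong ((2 ℕ.* r) C_) (double-suc α))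
    (C-sym (2 ℕ.* β ℕ.+ 1) (2 ℕ.* α ℕ.+ 1) (trans (odd-sum α β) (cong (λ x → 2 ℕ.* suc x) α+β≡q)))

  E-last : E r ≡ 1ℚ
  E-last = cong ℕ→ℚ (nCn≡1 (2 ℕ.* r))

  E-first : E 0 ≡ 1ℚ
  E-first = cong ℕ→ℚ (trans (nCk≡nC[n∸k] (z≤n {2 ℕ.* r})) (nCn≡1 (2 ℕ.* r)))

  O-vanishes : ∀ {α} → r ≤ α → O α ≡ 0ℚ
  O-vanishes {α} r≤α =
    cong ℕ→ℚ (k>n⇒nCk≡0 (ℕP.≤-<-trans (ℕP.*-monoʳ-≤ 2 r≤α) (ℕP.m<m+n (2 ℕ.* α) ℕP.0<1+n)))

+1-injective : ∀ {m n} → m ℕ.+ 1 ≡ suc n → m ≡ n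
+1-injective {m} eq = ℕP.suc-injective (trans (ℕP.+-comm 1 m) eq)

+1-cong : ∀ {m n} → m ≡ n → m ℕ.+ 1 ≡ suc n
+1-cong {m} eq = trans (ℕP.+-comm m 1) (cong suc eq)

module Rows (b q : ℕ) where

  open Coefficients q public

  F G D : ℕ → ℚ
  F = onLine b r (λ α β → c α β r)
  G = onLine b r (λ α β → c β α r)
  D α = F α - G α

  -- the first row that meets the line α + β + 1 = r
  α₀ : ℕ
  α₀ = q ∸ b

  partner≤b : ∀ {α} → α₀ ≤ α → q ∸ α ≤ b
  partner≤b {α} α₀≤α = ℕP.m≤n+o⇒m∸n≤o q α (begin
    q            ≤⟨ ℕP.m≤n+m∸n q b ⟩
    b ℕ.+ α₀     ≤⟨ ℕP.+-monoʳ-≤ b α₀≤α ⟩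
    b ℕ.+ α      ≡⟨ ℕP.+-comm b α ⟩
    α ℕ.+ b      ∎)
    where open ℕP.≤-Reasoning

  off-line : ∀ {α β} → α < α₀ ⊎ q < α → β ≤ b → α ℕ.+ β ℕ.+ 1 ≢ r
  off-line {α} {β} (inj₁ α<α₀) β≤b line = ℕP.<⇒≱ α<α₀ (ℕP.m≤n+o⇒m∸n≤o q b (begin
    q          ≡⟨ sym (+1-injective line) ⟩
    α ℕ.+ β    ≤⟨ ℕP.+-monoʳ-≤ α β≤b ⟩
    α ℕ.+ b    ≡⟨ ℕP.+-comm α b ⟩
    b ℕ.+ α    ∎))
    where open ℕP.≤-Reasoning
  off-line {α} {β} (inj₂ q<α) β≤b line =
    ℕP.<⇒≱ q<α (ℕP.≤-trans (ℕP.m≤m+n α β) (ℕP.≤-reflexive (+1-injective line)))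

  F-hit : ∀ {α} → α₀ ≤ α → α ≤ q → F α ≡ s * (E α - k * O α)
  F-hit {α} α₀≤α α≤q =
    trans (onLine-hit (λ α β → c α β r) (partner≤b α₀≤α) (+1-cong (ℕP.m+[n∸m]≡n α≤q)))
          (c-onLine {β = q ∸ α} (ℕP.m+[n∸m]≡n α≤q))

  G-hit : ∀ {α} → α₀ ≤ α → α ≤ q → G α ≡ s * (E (suc α) - k * O α)
  G-hit {α} α₀≤α α≤q =
    trans (onLine-hit (λ α β → c β α r) (partner≤b α₀≤α) (+1-cong (ℕP.m+[n∸m]≡n α≤q)))
          (c-onLine-swap {β = q ∸ α} (ℕP.m+[n∸m]≡n α≤q))

  F-miss : ∀ {α} → α < α₀ ⊎ q < α → F α ≡ 0ℚ
  F-miss out = onLine-miss (λ α β → c α β r) (off-line out)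

  G-miss : ∀ {α} → α < α₀ ⊎ q < α → G α ≡ 0ℚ
  G-miss out = onLine-miss (λ α β → c β α r) (off-line out)

  D-hit : ∀ {α} → α₀ ≤ α → α ≤ q → D α ≡ s * E α - s * E (suc α)
  D-hit {α} α₀≤α α≤q = trans (cong₂ _-_ (F-hit α₀≤α α≤q) (G-hit α₀≤α α≤q))
    (solve 4 (λ s x y o → s :* (x :- o) :- s :* (y :- o) := s :* x :- s :* y) refl
             s (E α) (E (suc α)) (k * O α))

  D-miss : ∀ {α} → α < α₀ ⊎ q < α → D α ≡ 0ℚ
  D-miss out = cong₂ _-_ (F-miss out) (G-miss out)

  ΣD : ∀ {n} → α₀ ≤ n → n ≤ r → Σ< n D ≡ s * E α₀ - s * E n
  ΣD α₀≤n n≤r = Σ<-telescope D (λ α → s * E α) (λ α<α₀ → D-miss (inj₁ α<α₀))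
    (λ α₀≤α α<n → D-hit α₀≤α (ℕP.≤-pred (ℕP.≤-trans α<n n≤r))) α₀≤n

  ΣF-ΣG : ∀ {a} → q ≤ a ℕ.+ b →
    Σ< (suc a) F - Σ< a G ≡ s * (E α₀ - k * O a) - s * 𝕀 (r ≤? a)
  ΣF-ΣG {a} q≤a+b = begin
    Σ< (suc a) F - Σ< a G     ≡⟨ solve 3 (λ x y z → (x :+ y) :- z := (x :- z) :+ y) refl
                                         (Σ< a F) (F a) (Σ< a G) ⟩
    (Σ< a F - Σ< a G) + F a   ≡⟨ cong (_+ F a) (Σ<-sub a F G) ⟩
    Σ< a D + F a              ≡⟨ last-row (r ≤? a) ⟩
    s * (E α₀ - k * O a) - s * 𝕀 (r ≤? a) ∎
    where
    open ≡-Reasoning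
    α₀≤a : α₀ ≤ a
    α₀≤a = ℕP.m≤n+o⇒m∸n≤o q b (ℕP.≤-trans q≤a+b (ℕP.≤-reflexive (ℕP.+-comm a b)))
    last-row : (r≤a? : Dec (r ≤ a)) → Σ< a D + F a ≡ s * (E α₀ - k * O a) - s * 𝕀 r≤a?
    last-row (yes r≤a) = begin
      Σ< a D + F a                   ≡⟨ cong₂ _+_ (Σ<-extend D (λ r≤i → D-miss (inj₂ r≤i)) r≤a)
                                                  (F-miss (inj₂ r≤a)) ⟩
      Σ< r D + 0ℚ                    ≡⟨ cong (_+ 0ℚ) (ΣD (ℕP.m≤n⇒m≤1+n (ℕP.m∸n≤m q b)) ℕP.≤-refl) ⟩
      (s * E α₀ - s * E r) + 0ℚ      ≡⟨ cong (λ e → (s * E α₀ - s * e) + 0ℚ) E-last ⟩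
      (s * E α₀ - s * 1ℚ) + 0ℚ       ≡⟨ solve 3 (λ s x k → (s :* x :- s :* con 1ℚ) :+ con 0ℚ
                                                  := s :* (x :- k :* con 0ℚ) :- s :* con 1ℚ) refl s (E α₀) k ⟩
      s * (E α₀ - k * 0ℚ) - s * 1ℚ   ≡⟨ cong (λ o → s * (E α₀ - k * o) - s * 1ℚ) (sym (O-vanishes r≤a)) ⟩
      s * (E α₀ - k * O a) - s * 1ℚ  ∎
    last-row (no r≰a) = begin
      Σ< a D + F a                             ≡⟨ cong₂ _+_ (ΣD α₀≤a (ℕP.m≤n⇒m≤1+n a≤q)) (F-hit α₀≤a a≤q) ⟩
      (s * E α₀ - s * E a) + s * (E a - k * O a) ≡⟨ solve 4 (λ s x y o → (s :* x :- s :* y) :+ s :* (y :- o)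
                                                                  := s :* (x :- o) :- s :* con 0ℚ) refl
                                                           s (E α₀) (E a) (k * O a) ⟩
      s * (E α₀ - k * O a) - s * 0ℚ            ∎
      where
      a≤q : a ≤ q
      a≤q = ℕP.≤-pred (ℕP.≰⇒> r≰a)

  E-α₀ : E α₀ ≡ ℕ→ℚ ((2 ℕ.* r) C (2 ℕ.* b ℕ.+ 2)) + 𝕀 (r ≤? b)
  E-α₀ = by-cases (r ≤? b)
    where
    open ≡-Reasoning
    by-cases : (r≤b? : Dec (r ≤ b)) → E α₀ ≡ ℕ→ℚ ((2 ℕ.* r) C (2 ℕ.* b ℕ.+ 2)) + 𝕀 r≤b?
    by-cases (yes r≤b) = begin
      E α₀                                   ≡⟨ cong E (ℕP.m≤n⇒m∸n≡0 (ℕP.≤-trans (ℕP.n≤1+n q) r≤b)) ⟩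
      E 0                                    ≡⟨ E-first ⟩
      1ℚ                                     ≡⟨ cong (λ x → ℕ→ℚ x + 1ℚ) (k>n⇒nCk≡0 2r<2b+2) ⟨
      ℕ→ℚ ((2 ℕ.* r) C (2 ℕ.* b ℕ.+ 2)) + 1ℚ ∎
      where
      2r<2b+2 : 2 ℕ.* r < 2 ℕ.* b ℕ.+ 2
      2r<2b+2 = ℕP.≤-<-trans (ℕP.*-monoʳ-≤ 2 r≤b) (ℕP.m<m+n (2 ℕ.* b) ℕP.0<1+n)
    by-cases (no r≰b) = begin
      E α₀                                   ≡⟨ cong ℕ→ℚ (C-sym (2 ℕ.* b ℕ.+ 2) (2 ℕ.* α₀) 2b+2+2α₀≡2r) ⟨
      ℕ→ℚ ((2 ℕ.* r) C (2 ℕ.* b ℕ.+ 2))      ≡⟨ +-identityʳ _ ⟨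
      ℕ→ℚ ((2 ℕ.* r) C (2 ℕ.* b ℕ.+ 2)) + 0ℚ ∎
      where
      2b+2+2α₀≡2r : 2 ℕ.* b ℕ.+ 2 ℕ.+ 2 ℕ.* α₀ ≡ 2 ℕ.* r
      2b+2+2α₀≡2r =
        trans (even-sum α₀ b) (cong (λ x → 2 ℕ.* suc x) (ℕP.m∸n+n≡m (ℕP.≤-pred (ℕP.≰⇒> r≰b))))

lemma4p33 : (a b r : ℕ) → 1 ≤ r → r ≤ a ℕ.+ b ℕ.+ 1 →
    c a b r ≡
      (Σ< (suc a) (λ α → Σ< (suc b) (λ β → when (α ℕ.+ β ℕ.+ 1 ≟ r) (c α β r)))
       - Σ< a (λ α → Σ< (suc b) (λ β → when (α ℕ.+ β ℕ.+ 1 ≟ r) (c β α r))))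
      + (ℕ→ℚ 2 * sgn r) * (𝕀 (r ≤? a) - 𝕀 (r ≤? b))
lemma4p33 a b (suc q) _ r≤a+b+1 = begin
  s * (B - k * O a)                                   ≡⟨ split-indicators s B (k * O a) 𝕀a 𝕀b ⟩
  (s * ((B + 𝕀b) - k * O a) - s * 𝕀a) + s * (𝕀a - 𝕀b) ≡⟨ cong (λ e → (s * (e - k * O a) - s * 𝕀a) + s * (𝕀a - 𝕀b))
                                                              (sym E-α₀) ⟩
  (s * (E α₀ - k * O a) - s * 𝕀a) + s * (𝕀a - 𝕀b)    ≡⟨ cong (_+ s * (𝕀a - 𝕀b)) (sym (ΣF-ΣG q≤a+b)) ⟩
  (Σ< (suc a) F - Σ< a G) + s * (𝕀a - 𝕀b)            ∎
  where
  open Rows b q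
  open ≡-Reasoning
  B 𝕀a 𝕀b : ℚ
  B = ℕ→ℚ ((2 ℕ.* r) C (2 ℕ.* b ℕ.+ 2))
  𝕀a = 𝕀 (r ≤? a)
  𝕀b = 𝕀 (r ≤? b)
  q≤a+b : q ≤ a ℕ.+ b
  q≤a+b = ℕP.≤-pred (ℕP.≤-trans r≤a+b+1 (ℕP.≤-reflexive (ℕP.+-comm (a ℕ.+ b) 1)))
  split-indicators : ∀ s x o i j → s * (x - o) ≡ (s * ((x + j) - o) - s * i) + s * (i - j)
  split-indicators = solve 5 (λ s x o i j → s :* (x :- o) := (s :* ((x :+ j) :- o) :- s :* i) :+ s :* (i :- j)) refl
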